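{- For all integers $b\ge2$ and all positive integers $n$, $$\overline{\overline{\bigl((b+1)n\bigr)\ominus_b n}} = n\oplus_{ -b}(-n).$$ In particular, for $b=2$: $n\oplus(3n)=n\oplus_{ -2}(-n)$, where $\oplus$ is bitwise exclusive or.
   Context: Let $x\bmod b$ denote the unique $r$ with $0\le r<b$ and $b\mid x-r$. For non-negative integers $\alpha=\sum_{i\ge0}a_ib^i$, $\beta=\sum_{i\ge0}b_ib^i$ with digits $a_i,b_i\in\{0,\dots,b-1\}$, define $\alpha\ominus_b\beta=\sum_{i\ge0}\bigl((a_i-b_i)\bmod b\bigr)b^i$, and define $\overline{\overline{\alpha}}=\sum_{i\ge0}\min(a_i,1)b^i$ (every nonzero base-$b$ digit replaced by $1$). Every integer $\alpha$ can be written uniquely as $\alpha=\sum_{i\ge0}a_i(-b)^i$ with $a_i\in\{0,\dots,b-1\}$, finitely many nonzero; for integers $\alpha=\sum a_i(-b)^i$, $\beta=\sum b_i(-b)^i$ written this way, define $\alpha\oplus_{ -b}\beta=\sum_{i\ge0}\bigl((a_i+b_i)\bmod b\bigr)b^i$. -}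

module Defs where

open import Data.Nat using (ℕ; zero; suc; _+_; _*_; _∸_; _^_; _≤_; NonZero)
open import Data.Nat.DivMod using (_/_; _%_)
open import Data.Integer using (ℤ; +_; -[1+_]; ∣_∣)
import Data.Integer as ℤ
open import Data.Integer.DivMod using (_%ℕ_; _/ℕ_)
open import Data.List using (List; []; _∷_)

-- Little-endian base-b digit list of a natural number.
-- The fuel argument bounds the number of digits produced; fuel x suffices
-- for x (since b ≥ 2 gives b^x > x).
digitsFuel : (b : ℕ) .{{_ : NonZero b}} → ℕ → ℕ → List ℕ
digitsFuel b zero    x = []
digitsFuel b (suc f) zero = []
digitsFuel b (suc f) x@(suc _) = (x % b) ∷ digitsFuel b f (x / b)

digits : (b : ℕ) .{{_ : NonZero b}} → ℕ → List ℕ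
digits b x = digitsFuel b x x

fromDigits : ℕ → List ℕ → ℕ
fromDigits b []       = 0
fromDigits b (d ∷ ds) = d + b * fromDigits b ds

zipDigits : (ℕ → ℕ → ℕ) → List ℕ → List ℕ → List ℕ
zipDigits f []       []       = []
zipDigits f []       (e ∷ es) = f 0 e ∷ zipDigits f [] es
zipDigits f (d ∷ ds) []       = f d 0 ∷ zipDigits f ds []
zipDigits f (d ∷ ds) (e ∷ es) = f d e ∷ zipDigits f ds es

-- (a - c) mod b for digits a, c < b
subMod : (b : ℕ) .{{_ : NonZero b}} → ℕ → ℕ → ℕ
subMod b a c = (a + b ∸ c) % b

addMod : (b : ℕ) .{{_ : NonZero b}} → ℕ → ℕ → ℕ
addMod b a c = (a + c) % b

⊖ : (b : ℕ) .{{_ : NonZero b}} → ℕ → ℕ → ℕ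
⊖ b α β = fromDigits b (zipDigits (subMod b) (digits b α) (digits b β))

-- double bar: replace every nonzero base-b digit by 1
min1 : ℕ → ℕ
min1 zero    = 0
min1 (suc _) = 1

bar : (b : ℕ) .{{_ : NonZero b}} → ℕ → ℕ
bar b α = fromDigits b (Data.List.map min1 (digits b α))
  where import Data.List

-- Base (-b) digits of an integer: a₀ = α mod b, then recurse on (α - a₀)/(-b).
-- Fuel ∣α∣ + 1 suffices for b ≥ 2.
negDigitsFuel : (b : ℕ) .{{_ : NonZero b}} → ℕ → ℤ → List ℕ
negDigitsFuel b zero    α = []
negDigitsFuel b (suc f) (+ zero) = []
negDigitsFuel b (suc f) α = a ∷ negDigitsFuel b f (ℤ.- ((α ℤ.- + a) /ℕ b))
  where a = α %ℕ b

negDigits : (b : ℕ) .{{_ : NonZero b}} → ℤ → List ℕ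
negDigits b α = negDigitsFuel b (suc ∣ α ∣) α

-- α ⊕_{-b} β : digitwise addition mod b of base-(-b) digits, read in base b
⊕neg : (b : ℕ) .{{_ : NonZero b}} → ℤ → ℤ → ℕ
⊕neg b α β = fromDigits b (zipDigits (addMod b) (negDigits b α) (negDigits b β))

{-# OPTIONS --safe #-}

-- Both sides are read off digit by digit from the least significant end.  For
-- A = (b+1)m + t with 0 ≤ t ≤ b, the lowest digit of A ⊖_b m is t mod b, and the
-- remaining digits are those of the same expression for m′ = ⌊m/b⌋ and
-- t′ = r + ⌊(r+t)/b⌋, where r = m mod b (t′ absorbs the carry of m + bm).  In base −b,
-- the pair (x, −y) has lowest digits summing to (x − y) mod b and continues, up to
-- swapping the arguments, as the pair (⌈y/b⌉, −⌊x/b⌋).  With x = m + ⌈t/b⌉ and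
-- y = m + ⌊t/b⌋ both sides emit the digit [t mod b ≠ 0] and move to the state (m′, t′),
-- so strong induction on m shows that they agree in every state; the theorem is the
-- state (n, 0).

module Submission where

open import Defs
open import Data.Integer using (+_; -[1+_]; -_; ∣_∣; 0ℤ; -1ℤ)
import Data.Integer as ℤ
import Data.Integer.Properties as ℤ
open import Data.Integer.DivMod using (_%ℕ_; _/ℕ_; a≡a%ℕn+[a/ℕn]*n)
open import Algebra.Properties.AbelianGroup ℤ.+-0-abelianGroup using (xyx⁻¹≈y)
open import Data.List using (List; []; _∷_; map; drop)
open import Data.Nat using (ℕ; zero; suc; _+_; _*_; _∸_; _≤_; _<_; z≤n; s≤s; z<s; NonZero)
open import Data.Nat.Properties
open import Algebra.Properties.CommutativeSemigroup +-commutativeSemigroup using (xy∙z≈xz∙y; xy∙z≈y∙zx)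
open import Data.Nat.DivMod
open import Data.Nat.Divisibility using (divides-refl; m∣m*n; m%n≡0⇒n∣m)
open import Data.Nat.Induction using (<-rec)
open import Data.Nat.Tactic.RingSolver using (solve)
open import Data.Sum using (inj₁; inj₂)
open import Function using (_∘_)
open import Relation.Binary.PropositionalEquality
open import Relation.Nullary using (contradiction; yes; no)
open ≡-Reasoning

head₀ : List ℕ → ℕ
head₀ []      = 0
head₀ (d ∷ _) = d

module _ (b : ℕ) where

  fromDigits-zipDigits : ∀ f → f 0 0 ≡ 0 → ∀ ds es {d e ds′ es′} →
    head₀ ds ≡ d → head₀ es ≡ e → drop 1 ds ≡ ds′ → drop 1 es ≡ es′ →
    fromDigits b (zipDigits f ds es) ≡ f d e + b * fromDigits b (zipDigits f ds′ es′)
  fromDigits-zipDigits f f00 []      []      refl refl refl refl = sym (cong₂ _+_ f00 (*-zeroʳ b))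
  fromDigits-zipDigits f f00 []      (_ ∷ _) refl refl refl refl = refl
  fromDigits-zipDigits f f00 (_ ∷ _) []      refl refl refl refl = refl
  fromDigits-zipDigits f f00 (_ ∷ _) (_ ∷ _) refl refl refl refl = refl

  fromDigits-map : ∀ f → f 0 ≡ 0 → ∀ ds {d ds′} → head₀ ds ≡ d → drop 1 ds ≡ ds′ →
    fromDigits b (map f ds) ≡ f d + b * fromDigits b (map f ds′)
  fromDigits-map f f0 []      refl refl = sym (cong₂ _+_ f0 (*-zeroʳ b))
  fromDigits-map f f0 (_ ∷ _) refl refl = refl

zipDigits-comm : ∀ f → (∀ x y → f x y ≡ f y x) → ∀ ds es → zipDigits f ds es ≡ zipDigits f es ds
zipDigits-comm f comm []       []       = refl
zipDigits-comm f comm []       (e ∷ es) = cong₂ _∷_ (comm 0 e) (zipDigits-comm f comm [] es)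
zipDigits-comm f comm (d ∷ ds) []       = cong₂ _∷_ (comm d 0) (zipDigits-comm f comm ds [])
zipDigits-comm f comm (d ∷ ds) (e ∷ es) = cong₂ _∷_ (comm d e) (zipDigits-comm f comm ds es)

module _ (b : ℕ) .{{_ : NonZero b}} where

  0%b≡0 : 0 % b ≡ 0
  0%b≡0 = n≤0⇒n≡0 (m%n≤m 0 b)

  [x+q*b]/b≡x/b+q : ∀ x q → (x + q * b) / b ≡ x / b + q
  [x+q*b]/b≡x/b+q x q = trans (+-distrib-/-∣ʳ x (divides-refl q)) (cong (λ v → x / b + v) (m*n/n≡m q b))

  [r+b*q]%b≡r : ∀ {r} q → r < b → (r + b * q) % b ≡ r
  [r+b*q]%b≡r {r} q r<b = begin
    (r + b * q) % b ≡⟨ cong (λ v → (r + v) % b) (*-comm b q) ⟩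
    (r + q * b) % b ≡⟨ [m+kn]%n≡m%n r q b ⟩
    r % b           ≡⟨ m<n⇒m%n≡m r<b ⟩
    r               ∎

  [r+b*q]/b≡q : ∀ {r} q → r < b → (r + b * q) / b ≡ q
  [r+b*q]/b≡q {r} q r<b = begin
    (r + b * q) / b ≡⟨ cong (λ v → (r + v) / b) (*-comm b q) ⟩
    (r + q * b) / b ≡⟨ [x+q*b]/b≡x/b+q r q ⟩
    r / b + q       ≡⟨ cong (_+ q) (m<n⇒m/n≡0 r<b) ⟩
    q               ∎

  ⌈_/b⌉ : ℕ → ℕ
  ⌈ c /b⌉ = c / b + min1 (c % b)

  ⌈x+q*b/b⌉≡⌈x/b⌉+q : ∀ x q → ⌈ x + q * b /b⌉ ≡ ⌈ x /b⌉ + q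
  ⌈x+q*b/b⌉≡⌈x/b⌉+q x q = begin
    (x + q * b) / b + min1 ((x + q * b) % b)
      ≡⟨ cong₂ (λ u v → u + min1 v) ([x+q*b]/b≡x/b+q x q) ([m+kn]%n≡m%n x q b) ⟩
    x / b + q + min1 (x % b)
      ≡⟨ xy∙z≈xz∙y (x / b) q (min1 (x % b)) ⟩
    ⌈ x /b⌉ + q ∎

  ⌈x/b⌉≡min1x : ∀ {x} → x ≤ b → ⌈ x /b⌉ ≡ min1 x
  ⌈x/b⌉≡min1x {zero}  _   = cong₂ (λ u v → u + min1 v) (0/n≡0 b) 0%b≡0
  ⌈x/b⌉≡min1x {suc x} x≤b with m≤n⇒m<n∨m≡n x≤b
  ... | inj₁ x<b = cong₂ (λ u v → u + min1 v) (m<n⇒m/n≡0 x<b) (m<n⇒m%n≡m x<b)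
  ... | inj₂ x≡b rewrite x≡b = cong₂ (λ u v → u + min1 v) (n/n≡1 b) (n%n≡0 b)

  [[c+d]%b+u]%b≡d%b : ∀ {u c} d → (u + c) % b ≡ 0 → ((c + d) % b + u) % b ≡ d % b
  [[c+d]%b+u]%b≡d%b {u} {c} d [u+c]%b≡0 = begin
    ((c + d) % b + u) % b         ≡⟨ %-distribˡ-+ ((c + d) % b) u b ⟩
    ((c + d) % b % b + u % b) % b ≡⟨ cong (λ v → (v + u % b) % b) (m%n%n≡m%n (c + d) b) ⟩
    ((c + d) % b + u % b) % b     ≡⟨ %-distribˡ-+ (c + d) u b ⟨
    (c + d + u) % b               ≡⟨ cong (_% b) (xy∙z≈y∙zx c d u) ⟩
    (d + (u + c)) % b             ≡⟨ %-remove-+ʳ d (m%n≡0⇒n∣m (u + c) b [u+c]%b≡0) ⟩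
    d % b                         ∎

  [b∸c%b+c]%b≡0 : ∀ c → (b ∸ c % b + c) % b ≡ 0
  [b∸c%b+c]%b≡0 c = begin
    (b ∸ c % b + c) % b                   ≡⟨ cong (λ v → (b ∸ c % b + v) % b) (m≡m%n+[m/n]*n c b) ⟩
    (b ∸ c % b + (c % b + c / b * b)) % b ≡⟨ cong (_% b) (+-assoc (b ∸ c % b) (c % b) (c / b * b)) ⟨
    (b ∸ c % b + c % b + c / b * b) % b   ≡⟨ [m+kn]%n≡m%n (b ∸ c % b + c % b) (c / b) b ⟩
    (b ∸ c % b + c % b) % b               ≡⟨ cong (_% b) (m∸n+n≡m (m%n≤n c b)) ⟩
    b % b                                 ≡⟨ n%n≡0 b ⟩
    0                                     ∎

  [-c%ℕb+c]%b≡0 : ∀ c → ((- + c) %ℕ b + c) % b ≡ 0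
  [-c%ℕb+c]%b≡0 zero = trans (cong (λ v → (v + 0) % b) 0%b≡0) 0%b≡0
  [-c%ℕb+c]%b≡0 (suc n) with suc n % b in eq
  ... | zero  = eq
  ... | suc r = subst (λ s → (b ∸ s + suc n) % b ≡ 0) eq ([b∸c%b+c]%b≡0 (suc n))

  subMod[y+d,y]≡d%b : ∀ y d → subMod b ((y + d) % b) (y % b) ≡ d % b
  subMod[y+d,y]≡d%b y d = begin
    ((y + d) % b + b ∸ y % b) % b   ≡⟨ cong (_% b) (+-∸-assoc ((y + d) % b) (m%n≤n y b)) ⟩
    ((y + d) % b + (b ∸ y % b)) % b ≡⟨ [[c+d]%b+u]%b≡d%b d ([b∸c%b+c]%b≡0 y) ⟩
    d % b                           ∎

  addMod[c+d,-c]≡d%b : ∀ c d → addMod b ((c + d) % b) ((- + c) %ℕ b) ≡ d % b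
  addMod[c+d,-c]≡d%b c d = [[c+d]%b+u]%b≡d%b d ([-c%ℕb+c]%b≡0 c)

  -[-c/ℕb]≡⌈c/b⌉ : ∀ c → - ((- + c) /ℕ b) ≡ + ⌈ c /b⌉
  -[-c/ℕb]≡⌈c/b⌉ zero    = trans (cong (-_ ∘ +_) (0/n≡0 b)) (cong +_ (sym (⌈x/b⌉≡min1x z≤n)))
  -[-c/ℕb]≡⌈c/b⌉ (suc n) with suc n % b
  ... | zero  = trans (ℤ.neg-involutive _) (cong +_ (sym (+-identityʳ _)))
  ... | suc _ = cong +_ (+-comm 1 (suc n / b))

  [i*b]/ℕb≡i : ∀ i → (i ℤ.* + b) /ℕ b ≡ i
  [i*b]/ℕb≡i (+ n)      = trans (cong (_/ℕ b) (sym (ℤ.pos-* n b))) (cong +_ (m*n/n≡m n b))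
  [i*b]/ℕb≡i -[1+ n ] = begin
    (-[1+ n ] ℤ.* + b) /ℕ b       ≡⟨ cong (_/ℕ b) -[1+n]*b≡-[[1+n]*b] ⟩
    (- + (suc n * b)) /ℕ b        ≡⟨ ℤ.neg-involutive _ ⟨
    - - ((- + (suc n * b)) /ℕ b)  ≡⟨ cong -_ (-[-c/ℕb]≡⌈c/b⌉ (suc n * b)) ⟩
    - + ⌈ suc n * b /b⌉           ≡⟨ cong (-_ ∘ +_) ⌈[1+n]*b/b⌉≡1+n ⟩
    -[1+ n ]                      ∎
    where
    -[1+n]*b≡-[[1+n]*b] : -[1+ n ] ℤ.* + b ≡ - + (suc n * b)
    -[1+n]*b≡-[[1+n]*b] = trans (sym (ℤ.neg-distribˡ-* (+ suc n) (+ b))) (cong -_ (sym (ℤ.pos-* (suc n) b)))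
    ⌈[1+n]*b/b⌉≡1+n : ⌈ suc n * b /b⌉ ≡ suc n
    ⌈[1+n]*b/b⌉≡1+n = trans (⌈x+q*b/b⌉≡⌈x/b⌉+q 0 (suc n)) (cong (_+ suc n) (⌈x/b⌉≡min1x z≤n))

  [i-i%ℕb]/ℕb≡i/ℕb : ∀ i → (i ℤ.- + (i %ℕ b)) /ℕ b ≡ i /ℕ b
  [i-i%ℕb]/ℕb≡i/ℕb i = begin
    (i ℤ.- + r) /ℕ b                  ≡⟨ cong (λ j → (j ℤ.- + r) /ℕ b) (a≡a%ℕn+[a/ℕn]*n i b) ⟩
    (+ r ℤ.+ q ℤ.* + b ℤ.- + r) /ℕ b  ≡⟨ cong (_/ℕ b) (xyx⁻¹≈y (+ r) (q ℤ.* + b)) ⟩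
    (q ℤ.* + b) /ℕ b                  ≡⟨ [i*b]/ℕb≡i q ⟩
    q                                 ∎
    where
    r = i %ℕ b
    q = i /ℕ b

  ⊕neg-comm : ∀ i j → ⊕neg b i j ≡ ⊕neg b j i
  ⊕neg-comm i j = cong (fromDigits b)
    (zipDigits-comm (addMod b) (λ x y → cong (_% b) (+-comm x y)) (negDigits b i) (negDigits b j))

  [r+t]/b≤1 : ∀ {r t} → r < b → t ≤ b → (r + t) / b ≤ 1
  [r+t]/b≤1 r<b t≤b = m<1+n⇒m≤n (m<n*o⇒m/o<n (+-mono-<-≤ r<b (≤-trans t≤b (m≤m+n b 0))))

  r+[r+t]/b≤b : ∀ {r t} → r < b → t ≤ b → r + (r + t) / b ≤ b
  r+[r+t]/b≤b {r} r<b t≤b = ≤-trans (+-monoʳ-≤ r ([r+t]/b≤1 r<b t≤b)) (subst (_≤ b) (+-comm 1 r) r<b)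

  [r+min1t]/b≡[r+[r+t]/b]/b : ∀ {r t} → r < b → t ≤ b → (r + min1 t) / b ≡ (r + (r + t) / b) / b
  [r+min1t]/b≡[r+[r+t]/b]/b {r} {zero} r<b _ =
    cong (λ c → (r + c) / b) (sym (m<n⇒m/n≡0 (subst (_< b) (sym (+-identityʳ r)) r<b)))
  [r+min1t]/b≡[r+[r+t]/b]/b {r} {t@(suc _)} r<b t≤b with (r + t) / b in c≡ | [r+t]/b≤1 r<b t≤b
  ... | zero        | _       = trans (m<n⇒m/n≡0 r+1<b) (sym (m<n⇒m/n≡0 (subst (_< b) (sym (+-identityʳ r)) r<b)))
    where
    r+1<b : r + 1 < b
    r+1<b = ≤-<-trans (+-monoʳ-≤ r (s≤s z≤n)) (m/n≡0⇒m<n c≡)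
  ... | suc zero    | _       = refl
  ... | suc (suc _) | s≤s ()

  min1[r+t/b]≡min1[r+[r+t]/b] : ∀ r t → min1 (r + t / b) ≡ min1 (r + (r + t) / b)
  min1[r+t/b]≡min1[r+[r+t]/b] zero    _ = refl
  min1[r+t/b]≡min1[r+[r+t]/b] (suc _) _ = refl

  module _ (1<b : 1 < b) where

    1+x/b≤x : ∀ x → suc x / b ≤ x
    1+x/b≤x x = m<1+n⇒m≤n (m/n<m (suc x) b 1<b)

    digitsFuel-irrelevant : ∀ {f g} x → x ≤ f → x ≤ g → digitsFuel b f x ≡ digitsFuel b g x
    digitsFuel-irrelevant {zero}  {zero}  zero _ _ = refl
    digitsFuel-irrelevant {zero}  {suc _} zero _ _ = refl
    digitsFuel-irrelevant {suc _} {zero}  zero _ _ = refl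
    digitsFuel-irrelevant {suc _} {suc _} zero _ _ = refl
    digitsFuel-irrelevant {suc f} {suc g} (suc x) (s≤s x≤f) (s≤s x≤g) =
      cong (suc x % b ∷_) (digitsFuel-irrelevant (suc x / b)
        (≤-trans (1+x/b≤x x) x≤f) (≤-trans (1+x/b≤x x) x≤g))

    head₀-digits : ∀ x → head₀ (digits b x) ≡ x % b
    head₀-digits zero    = sym 0%b≡0
    head₀-digits (suc x) = refl

    drop1-digits : ∀ x → drop 1 (digits b x) ≡ digits b (x / b)
    drop1-digits zero    = cong (digits b) (sym (0/n≡0 b))
    drop1-digits (suc x) = digitsFuel-irrelevant (suc x / b) (1+x/b≤x x) ≤-refl

    bar⊖-rec : ∀ y d → bar b (⊖ b (y + d) y) ≡ min1 (d % b) + b * bar b (⊖ b ((y + d) / b) (y / b))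
    bar⊖-rec y d = begin
      bar b (⊖ b (y + d) y)
        ≡⟨ cong (bar b) ⊖-rec ⟩
      bar b (d % b + b * R)
        ≡⟨ fromDigits-map b min1 refl (digits b x) (head₀-digits x) (drop1-digits x) ⟩
      min1 ((d % b + b * R) % b) + b * bar b ((d % b + b * R) / b)
        ≡⟨ cong₂ (λ u v → min1 u + b * bar b v) ([r+b*q]%b≡r R (m%n<n d b)) ([r+b*q]/b≡q R (m%n<n d b)) ⟩
      min1 (d % b) + b * bar b R ∎
      where
      R = ⊖ b ((y + d) / b) (y / b)
      x = d % b + b * R
      ⊖-rec : ⊖ b (y + d) y ≡ d % b + b * R
      ⊖-rec = trans
        (fromDigits-zipDigits b (subMod b) (n%n≡0 b) (digits b (y + d)) (digits b y)
          (head₀-digits (y + d)) (head₀-digits y) (drop1-digits (y + d)) (drop1-digits y))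
        (cong (_+ b * R) (subMod[y+d,y]≡d%b y d))

    ⌈m/b⌉<m : ∀ {m} → 1 < m → ⌈ m /b⌉ < m
    ⌈m/b⌉<m {suc zero} (s≤s ())
    ⌈m/b⌉<m {m@(suc (suc _))} 1<m with m % b in m%b≡
    ... | zero  = subst (_< m) (sym (+-identityʳ (m / b))) (m/n<m m b 1<b)
    ... | suc r = subst (_< m) (+-comm 1 (m / b))
                    (1+q<m (m / b) (trans (m≡m%n+[m/n]*n m b) (cong (_+ m / b * b) m%b≡)))
      where
      1+q<m : ∀ q → m ≡ suc r + q * b → suc q < m
      1+q<m zero    _  = 1<m
      1+q<m (suc q) m≡ = subst (suc (suc q) <_) (sym m≡)
        (s≤s (<-≤-trans (m<m*n (suc q) b 1<b) (m≤n+m (suc q * b) r)))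

    ∣-[i/ℕb]∣<∣i∣ : ∀ i → i ≢ 0ℤ → i ≢ -1ℤ → ∣ - (i /ℕ b) ∣ < ∣ i ∣
    ∣-[i/ℕb]∣<∣i∣ (+ zero)        i≢0 _    = contradiction refl i≢0
    ∣-[i/ℕb]∣<∣i∣ (+ suc n)       _   _    =
      subst (_< suc n) (sym (ℤ.∣-i∣≡∣i∣ (+ (suc n / b)))) (m/n<m (suc n) b 1<b)
    ∣-[i/ℕb]∣<∣i∣ -[1+ zero ]     _   i≢-1 = contradiction refl i≢-1
    ∣-[i/ℕb]∣<∣i∣ (-[1+ suc n ])  _   _    =
      subst (_< suc (suc n)) (cong ∣_∣ (sym (-[-c/ℕb]≡⌈c/b⌉ (suc (suc n))))) (⌈m/b⌉<m (s≤s (s≤s z≤n)))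

    -[-1/ℕb]≡1 : - (-1ℤ /ℕ b) ≡ + 1
    -[-1/ℕb]≡1 = trans (-[-c/ℕb]≡⌈c/b⌉ 1) (cong +_ (⌈x/b⌉≡min1x (<⇒≤ 1<b)))

    negDigitsFuel-∷ : ∀ f i → i ≢ 0ℤ → negDigitsFuel b (suc f) i ≡ i %ℕ b ∷ negDigitsFuel b f (- (i /ℕ b))
    negDigitsFuel-∷ f (+ zero)        i≢0 = contradiction refl i≢0
    negDigitsFuel-∷ f i@(+ suc _)     _   = cong (λ j → i %ℕ b ∷ negDigitsFuel b f (- j)) ([i-i%ℕb]/ℕb≡i/ℕb i)
    negDigitsFuel-∷ f i@(-[1+ _ ])    _   = cong (λ j → i %ℕ b ∷ negDigitsFuel b f (- j)) ([i-i%ℕb]/ℕb≡i/ℕb i)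

    negDigitsFuel-+1 : ∀ {f} → 0 < f → negDigitsFuel b f (+ 1) ≡ 1 % b ∷ []
    negDigitsFuel-+1 {suc f} _ = begin
      negDigitsFuel b (suc f) (+ 1)           ≡⟨ negDigitsFuel-∷ f (+ 1) (λ ()) ⟩
      1 % b ∷ negDigitsFuel b f (- + (1 / b)) ≡⟨ cong (λ q → 1 % b ∷ negDigitsFuel b f (- + q)) (m<n⇒m/n≡0 1<b) ⟩
      1 % b ∷ negDigitsFuel b f 0ℤ            ≡⟨ cong (1 % b ∷_) (negDigitsFuel-0 f) ⟩
      1 % b ∷ []                              ∎
      where
      negDigitsFuel-0 : ∀ f → negDigitsFuel b f 0ℤ ≡ []
      negDigitsFuel-0 zero    = refl
      negDigitsFuel-0 (suc _) = refl

    negDigitsFuel--1 : ∀ {f} → 1 < f → negDigitsFuel b f -1ℤ ≡ -1ℤ %ℕ b ∷ 1 % b ∷ []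
    negDigitsFuel--1 {suc f} (s≤s 0<f) = begin
      negDigitsFuel b (suc f) -1ℤ                 ≡⟨ negDigitsFuel-∷ f -1ℤ (λ ()) ⟩
      -1ℤ %ℕ b ∷ negDigitsFuel b f (- (-1ℤ /ℕ b)) ≡⟨ cong (λ j → -1ℤ %ℕ b ∷ negDigitsFuel b f j) -[-1/ℕb]≡1 ⟩
      -1ℤ %ℕ b ∷ negDigitsFuel b f (+ 1)          ≡⟨ cong (-1ℤ %ℕ b ∷_) (negDigitsFuel-+1 0<f) ⟩
      -1ℤ %ℕ b ∷ 1 % b ∷ []                       ∎

    negDigitsFuel-irrelevant : ∀ {f g} i → ∣ i ∣ < f → ∣ i ∣ < g → negDigitsFuel b f i ≡ negDigitsFuel b g i
    negDigitsFuel-irrelevant {suc f} {suc g} i i<f i<g with i ℤ.≟ 0ℤ | i ℤ.≟ -1ℤ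
    ... | yes refl | _        = refl
    -- −1 = (b − 1) + (−b)·1 is the one nonzero i with ∣ i /ℕ b ∣ not below ∣ i ∣.
    ... | no _     | yes refl = trans (negDigitsFuel--1 i<f) (sym (negDigitsFuel--1 i<g))
    ... | no i≢0   | no i≢-1  = begin
      negDigitsFuel b (suc f) i                 ≡⟨ negDigitsFuel-∷ f i i≢0 ⟩
      i %ℕ b ∷ negDigitsFuel b f (- (i /ℕ b))   ≡⟨ cong (i %ℕ b ∷_) (negDigitsFuel-irrelevant (- (i /ℕ b)) (shrink i<f) (shrink i<g)) ⟩
      i %ℕ b ∷ negDigitsFuel b g (- (i /ℕ b))   ≡⟨ negDigitsFuel-∷ g i i≢0 ⟨
      negDigitsFuel b (suc g) i                 ∎
      where
      shrink : ∀ {h} → ∣ i ∣ < suc h → ∣ - (i /ℕ b) ∣ < h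
      shrink (s≤s i≤h) = <-≤-trans (∣-[i/ℕb]∣<∣i∣ i i≢0 i≢-1) i≤h

    head₀-negDigits : ∀ i → head₀ (negDigits b i) ≡ i %ℕ b
    head₀-negDigits (+ zero)  = sym 0%b≡0
    head₀-negDigits (+ suc _) = refl
    head₀-negDigits -[1+ _ ]  = refl

    drop1-negDigits : ∀ i → drop 1 (negDigits b i) ≡ negDigits b (- (i /ℕ b))
    drop1-negDigits i with i ℤ.≟ 0ℤ | i ℤ.≟ -1ℤ
    ... | yes refl | _        = cong (negDigits b ∘ -_ ∘ +_) (sym (0/n≡0 b))
    ... | no _     | yes refl = begin
      drop 1 (negDigits b -1ℤ)   ≡⟨ cong (drop 1) (negDigitsFuel--1 (s≤s (s≤s z≤n))) ⟩
      1 % b ∷ []                 ≡⟨ negDigitsFuel-+1 z<s ⟨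
      negDigits b (+ 1)          ≡⟨ cong (negDigits b) -[-1/ℕb]≡1 ⟨
      negDigits b (- (-1ℤ /ℕ b)) ∎
    ... | no i≢0   | no i≢-1  = begin
      drop 1 (negDigits b i)                  ≡⟨ cong (drop 1) (negDigitsFuel-∷ ∣ i ∣ i i≢0) ⟩
      negDigitsFuel b ∣ i ∣ (- (i /ℕ b))      ≡⟨ negDigitsFuel-irrelevant (- (i /ℕ b)) (∣-[i/ℕb]∣<∣i∣ i i≢0 i≢-1) ≤-refl ⟩
      negDigits b (- (i /ℕ b))                ∎

    ⊕neg-rec : ∀ i j → ⊕neg b i j ≡ addMod b (i %ℕ b) (j %ℕ b) + b * ⊕neg b (- (i /ℕ b)) (- (j /ℕ b))
    ⊕neg-rec i j = fromDigits-zipDigits b (addMod b) 0%b≡0 (negDigits b i) (negDigits b j)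
      (head₀-negDigits i) (head₀-negDigits j) (drop1-negDigits i) (drop1-negDigits j)

    ⊕neg±-rec : ∀ c d → ⊕neg b (+ (c + d)) (- + c) ≡ d % b + b * ⊕neg b (+ ⌈ c /b⌉) (- + ((c + d) / b))
    ⊕neg±-rec c d = begin
      ⊕neg b (+ (c + d)) (- + c)
        ≡⟨ ⊕neg-rec (+ (c + d)) (- + c) ⟩
      addMod b ((c + d) % b) ((- + c) %ℕ b) + b * ⊕neg b (- + ((c + d) / b)) (- ((- + c) /ℕ b))
        ≡⟨ cong₂ (λ u j → u + b * ⊕neg b (- + ((c + d) / b)) j) (addMod[c+d,-c]≡d%b c d) (-[-c/ℕb]≡⌈c/b⌉ c) ⟩
      d % b + b * ⊕neg b (- + ((c + d) / b)) (+ ⌈ c /b⌉)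
        ≡⟨ cong (λ v → d % b + b * v) (⊕neg-comm (- + ((c + d) / b)) (+ ⌈ c /b⌉)) ⟩
      d % b + b * ⊕neg b (+ ⌈ c /b⌉) (- + ((c + d) / b)) ∎

    min1<b : ∀ x → min1 x < b
    min1<b zero    = <-trans z<s 1<b
    min1<b (suc _) = 1<b

    Agree : ℕ → ℕ → Set
    Agree m t = bar b (⊖ b (m + (b * m + t)) m) ≡ ⊕neg b (+ (m + ⌈ t /b⌉)) (- + (m + t / b))

    bar⊖-step : ∀ {r} m t → r < b →
      bar b (⊖ b (r + m * b + (b * (r + m * b) + t)) (r + m * b)) ≡
      min1 (t % b) + b * bar b (⊖ b (m + (b * m + (r + (r + t) / b))) m)
    bar⊖-step {r} m t r<b = begin
      bar b (⊖ b (M + (b * M + t)) M)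
        ≡⟨ bar⊖-rec M (b * M + t) ⟩
      min1 ((b * M + t) % b) + b * bar b (⊖ b ((M + (b * M + t)) / b) (M / b))
        ≡⟨ cong₂ (λ u v → min1 u + b * v) (%-remove-+ˡ t (m∣m*n M))
                 (cong₂ (λ x y → bar b (⊖ b x y)) [M+[b*M+t]]/b M/b≡m) ⟩
      min1 (t % b) + b * bar b (⊖ b (m + (b * m + (r + (r + t) / b))) m) ∎
      where
      M = r + m * b
      M/b≡m : M / b ≡ m
      M/b≡m = trans ([x+q*b]/b≡x/b+q r m) (cong (_+ m) (m<n⇒m/n≡0 r<b))
      [M+[b*M+t]]/b : (M + (b * M + t)) / b ≡ m + (b * m + (r + (r + t) / b))
      [M+[b*M+t]]/b = begin
        (M + (b * M + t)) / b                  ≡⟨ cong (_/ b) regroup ⟩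
        ((r + t) + (m + (b * m + r)) * b) / b  ≡⟨ [x+q*b]/b≡x/b+q (r + t) (m + (b * m + r)) ⟩
        (r + t) / b + (m + (b * m + r))        ≡⟨ shuffle ((r + t) / b) ⟩
        m + (b * m + (r + (r + t) / b))        ∎
        where
        regroup : r + m * b + (b * (r + m * b) + t) ≡ (r + t) + (m + (b * m + r)) * b
        regroup = solve (r ∷ m ∷ t ∷ b ∷ [])
        shuffle : ∀ c → c + (m + (b * m + r)) ≡ m + (b * m + (r + c))
        shuffle c = solve (c ∷ m ∷ r ∷ b ∷ [])

    ⊕neg-step : ∀ {r} m t → r < b → t ≤ b →
      ⊕neg b (+ (r + m * b + ⌈ t /b⌉)) (- + (r + m * b + t / b)) ≡
      min1 (t % b) + b * ⊕neg b (+ (m + ⌈ r + (r + t) / b /b⌉)) (- + (m + (r + (r + t) / b) / b))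
    ⊕neg-step {r} m t r<b t≤b = begin
      ⊕neg b (+ (M + ⌈ t /b⌉)) (- + (M + t / b))
        ≡⟨ cong (λ a → ⊕neg b (+ a) (- + (M + t / b))) (+-assoc M (t / b) (min1 (t % b))) ⟨
      ⊕neg b (+ (M + t / b + min1 (t % b))) (- + (M + t / b))
        ≡⟨ ⊕neg±-rec (M + t / b) (min1 (t % b)) ⟩
      min1 (t % b) % b + b * ⊕neg b (+ ⌈ M + t / b /b⌉) (- + ((M + t / b + min1 (t % b)) / b))
        ≡⟨ cong₂ (λ u v → u + b * v) (m<n⇒m%n≡m (min1<b (t % b)))
                 (cong₂ (λ x y → ⊕neg b (+ x) (- + y)) ceiling floor) ⟩
      min1 (t % b) + b * ⊕neg b (+ (m + ⌈ t′ /b⌉)) (- + (m + t′ / b)) ∎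
      where
      M  = r + m * b
      t′ = r + (r + t) / b
      t′≤b : t′ ≤ b
      t′≤b = r+[r+t]/b≤b r<b t≤b
      r+t/b≤b : r + t / b ≤ b
      r+t/b≤b = ≤-trans (+-monoʳ-≤ r (/-monoˡ-≤ b (m≤n+m t r))) t′≤b
      ceiling : ⌈ M + t / b /b⌉ ≡ m + ⌈ t′ /b⌉
      ceiling = begin
        ⌈ M + t / b /b⌉         ≡⟨ cong ⌈_/b⌉ (xy∙z≈xz∙y r (m * b) (t / b)) ⟩
        ⌈ r + t / b + m * b /b⌉ ≡⟨ ⌈x+q*b/b⌉≡⌈x/b⌉+q (r + t / b) m ⟩
        ⌈ r + t / b /b⌉ + m     ≡⟨ cong (_+ m) (⌈x/b⌉≡min1x r+t/b≤b) ⟩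
        min1 (r + t / b) + m    ≡⟨ cong (_+ m) (min1[r+t/b]≡min1[r+[r+t]/b] r t) ⟩
        min1 t′ + m             ≡⟨ cong (_+ m) (⌈x/b⌉≡min1x t′≤b) ⟨
        ⌈ t′ /b⌉ + m            ≡⟨ +-comm ⌈ t′ /b⌉ m ⟩
        m + ⌈ t′ /b⌉            ∎
      floor : (M + t / b + min1 (t % b)) / b ≡ m + t′ / b
      floor = begin
        (M + t / b + min1 (t % b)) / b ≡⟨ cong (_/ b) (+-assoc M (t / b) (min1 (t % b))) ⟩
        (M + ⌈ t /b⌉) / b              ≡⟨ cong (_/ b) (xy∙z≈xz∙y r (m * b) ⌈ t /b⌉) ⟩
        (r + ⌈ t /b⌉ + m * b) / b      ≡⟨ [x+q*b]/b≡x/b+q (r + ⌈ t /b⌉) m ⟩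
        (r + ⌈ t /b⌉) / b + m          ≡⟨ cong (λ c → (r + c) / b + m) (⌈x/b⌉≡min1x t≤b) ⟩
        (r + min1 t) / b + m           ≡⟨ cong (_+ m) ([r+min1t]/b≡[r+[r+t]/b]/b r<b t≤b) ⟩
        t′ / b + m                     ≡⟨ +-comm (t′ / b) m ⟩
        m + t′ / b                     ∎

    agree-step : ∀ {r} m t → r < b → t ≤ b → Agree m (r + (r + t) / b) → Agree (r + m * b) t
    agree-step m t r<b t≤b ih =
      trans (bar⊖-step m t r<b) (trans (cong (λ v → min1 (t % b) + b * v) ih) (sym (⊕neg-step m t r<b t≤b)))

    agree-0-0 : Agree 0 0
    agree-0-0 = trans (cong (λ x → bar b (⊖ b x 0)) (trans (+-identityʳ (b * 0)) (*-zeroʳ b)))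
                      (sym (cong₂ (λ x y → ⊕neg b (+ x) (- + y)) (⌈x/b⌉≡min1x z≤n) (0/n≡0 b)))

    agree : ∀ m t → t ≤ b → Agree m t
    agree = <-rec (λ m → ∀ t → t ≤ b → Agree m t) agree-<
      where
      agree-< : ∀ m → (∀ {m′} → m′ < m → ∀ t → t ≤ b → Agree m′ t) → ∀ t → t ≤ b → Agree m t
      -- For m = 0, t passes to ⌊t/b⌋ ≤ 1 and then to 0.
      agree-< zero _ t t≤b =
        agree-step 0 t 0<b t≤b (agree-step 0 (t / b) 0<b t/b≤b (subst (Agree 0) (sym t/b/b≡0) agree-0-0))
        where
        0<b : 0 < b
        0<b = <-trans z<s 1<b
        t/b≤b : t / b ≤ b
        t/b≤b = ≤-trans ([r+t]/b≤1 0<b t≤b) (<⇒≤ 1<b)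
        t/b/b≡0 : t / b / b ≡ 0
        t/b/b≡0 = m<n⇒m/n≡0 (≤-<-trans ([r+t]/b≤1 0<b t≤b) 1<b)
      agree-< m@(suc _) ih t t≤b = subst (λ m → Agree m t) (sym (m≡m%n+[m/n]*n m b))
        (agree-step (m / b) t (m%n<n m b) t≤b
          (ih (m/n<m m b 1<b) (m % b + (m % b + t) / b) (r+[r+t]/b≤b (m%n<n m b) t≤b)))

    bar⊖≡⊕neg : ∀ n → bar b (⊖ b (n + b * n) n) ≡ ⊕neg b (+ n) (- + n)
    bar⊖≡⊕neg n = begin
      bar b (⊖ b (n + b * n) n)               ≡⟨ cong (λ x → bar b (⊖ b (n + x) n)) (+-identityʳ (b * n)) ⟨
      bar b (⊖ b (n + (b * n + 0)) n)         ≡⟨ agree n 0 z≤n ⟩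
      ⊕neg b (+ (n + ⌈ 0 /b⌉)) (- + (n + 0 / b)) ≡⟨ cong₂ (λ x y → ⊕neg b (+ (n + x)) (- + (n + y))) (⌈x/b⌉≡min1x z≤n) (0/n≡0 b) ⟩
      ⊕neg b (+ (n + 0)) (- + (n + 0))        ≡⟨ cong (λ x → ⊕neg b (+ x) (- + x)) (+-identityʳ n) ⟩
      ⊕neg b (+ n) (- + n)                    ∎

theorem1 : (b : ℕ) → .{{_ : NonZero b}} → 2 ≤ b → (n : ℕ) → .{{_ : NonZero n}} →
    bar b (⊖ b ((b + 1) * n) n) ≡ ⊕neg b (+ n) (- (+ n))
theorem1 b 2≤b n = begin
  bar b (⊖ b ((b + 1) * n) n) ≡⟨ cong (λ x → bar b (⊖ b x n)) [b+1]*n≡n+b*n ⟩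
  bar b (⊖ b (n + b * n) n)   ≡⟨ bar⊖≡⊕neg b 2≤b n ⟩
  ⊕neg b (+ n) (- (+ n))      ∎
  where
  [b+1]*n≡n+b*n : (b + 1) * n ≡ n + b * n
  [b+1]*n≡n+b*n = solve (b ∷ n ∷ [])
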